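{- The functor $\mathrm{Low} : \mathbf{FrmSim} \to \mathbf{CABAOSim}$ is full: every simulatory relation $Q : (\mathcal{P}(X), \Box_R) \to (\mathcal{P}(Y), \Box_S)$ equals $\mathrm{Low}(T)$ for some simulation $T$ from $(X,R)$ to $(Y,S)$.
   Context: $\mathbf{FrmSim}$: Kripke frames $(X,R)$ ($R \subseteq X\times X$) and simulations ($Q \subseteq X\times Y$ such that $x \mathrel{Q} y$, $x \mathrel{R} x'$ imply some $y'$ with $y \mathrel{S} y'$, $x' \mathrel{Q} y'$). $\mathrm{Low}$ sends $(X,R)$ to $(\mathcal{P}(X), \Box_R)$ and $Q$ to $\mathrm{Low}(Q)$, where $A \mathrel{\mathrm{Low}(Q)} B$ iff $\forall a \in A.\ \exists b\in B.\ a \mathrel{Q} b$. Here $\Box_R(A)=\{w \mid \forall v.\ w\mathrel{R} v\Rightarrow v \in A\}$, with left adjoint $\Diamond^{ - }_R(A) = \{w \mid \exists v\in A.\ v\mathrel{R} w\}$. A CABAO is a complete atomic Boolean algebra with a meet-preserving $\Box$, whose left adjoint is written $\Diamond^{ - }$. A relation $Q$ between CABAOs is simulatory if it is directionally atomic — a bimodule ($p'\sqsubseteq p \mathrel{Q} q \sqsubseteq q' \Rightarrow p'\mathrel{Q} q'$), left-disjunctive ($a_i \mathrel{Q} b$ for all $i$ implies $\bigsqcup_i a_i \mathrel{Q} b$), atomic-founded (for atom $a$, $a \mathrel{Q} b$ implies $a \mathrel{Q} b'$ for some atom $b'\sqsubseteq b$) — and $A \mathrel{Q} \Box B$ implies $\Diamond^{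 - } A \mathrel{Q} B$. $\mathbf{CABAOSim}$: CABAOs and simulatory relations. -}

module Defs where

open import Level using (Level; _⊔_; suc)
open import Data.Product using (Σ; ∃; _×_; _,_)
open import Relation.Unary using (Pred; _∈_; _⊆_; _≐_; ｛_｝; ⋃)
open import Function.Bundles using (_⇔_)

𝒫 : ∀ {ℓ} → Set ℓ → Set (suc ℓ)
𝒫 {ℓ} X = Pred X ℓ

Frame-Rel : ∀ {ℓ} → Set ℓ → Set (suc ℓ)
Frame-Rel {ℓ} X = X → X → Set ℓ

IsSimulation : ∀ {ℓ q} {X Y : Set ℓ} → Frame-Rel X → Frame-Rel Y → (X → Y → Set q) → Set (ℓ ⊔ q)
IsSimulation {X = X} {Y} R S Q =
  ∀ (x : X) (y : Y) (x′ : X) → Q x y → R x x′ → Σ Y (λ y′ → S y y′ × Q x′ y′)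

-- Box and its left adjoint on the powerset algebra
□ : ∀ {ℓ} {X : Set ℓ} → Frame-Rel X → 𝒫 X → 𝒫 X
□ R A = λ w → ∀ v → R w v → v ∈ A

◇⁻ : ∀ {ℓ} {X : Set ℓ} → Frame-Rel X → 𝒫 X → 𝒫 X
◇⁻ {X = X} R A = λ w → Σ X (λ v → v ∈ A × R v w)

Low : ∀ {ℓ q} {X Y : Set ℓ} → (X → Y → Set q) → 𝒫 X → 𝒫 Y → Set (ℓ ⊔ q)
Low {X = X} {Y} T A B = ∀ (a : X) → a ∈ A → Σ Y (λ b → b ∈ B × T a b)

IsAtom : ∀ {ℓ} {X : Set ℓ} → 𝒫 X → Set ℓ
IsAtom {X = X} a = Σ X (λ x → a ≐ ｛ x ｝)

record DirectionallyAtomic {ℓ q} {X Y : Set ℓ} (Q : 𝒫 X → 𝒫 Y → Set q) : Set (suc ℓ ⊔ q) where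
  field
    bimodule : ∀ {p p′ : 𝒫 X} {r r′ : 𝒫 Y} → p′ ⊆ p → Q p r → r ⊆ r′ → Q p′ r′
    left-disjunctive : ∀ (I : Set ℓ) (a : I → 𝒫 X) (b : 𝒫 Y) →
      (∀ i → Q (a i) b) → Q (⋃ I a) b
    atomic-founded : ∀ (a : 𝒫 X) (b : 𝒫 Y) → IsAtom a → Q a b →
      Σ (𝒫 Y) (λ b′ → IsAtom b′ × b′ ⊆ b × Q a b′)

record IsSimulatory {ℓ q} {X Y : Set ℓ} (R : Frame-Rel X) (S : Frame-Rel Y)
                    (Q : 𝒫 X → 𝒫 Y → Set q) : Set (suc ℓ ⊔ q) where
  field
    dir-atomic : DirectionallyAtomic Q
    box-cond : ∀ (A : 𝒫 X) (B : 𝒫 Y) → Q A (□ S B) → Q (◇⁻ R A) B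

{-# OPTIONS --safe #-}
-- A directionally atomic Q is determined by its values on pairs of atoms: left-disjunctivity
-- rebuilds Q A B from the singletons below A, and atomic foundedness reads a point of B off
-- Q ｛ a ｝ B. So Q = Low T for T x y = Q ｛ x ｝ ｛ y ｝. If T x y and R x x′, the box condition
-- applied to ｛ y ｝ ⊆ □ S (S y) gives Q ｛ x′ ｝ (S y), and atomic foundedness then picks an
-- S-successor y′ of y with T x′ y′.
module Submission where

open import Defs
open import Data.Product using (Σ; ∃; _×_; _,_; proj₁)
open import Function.Base using (id)
open import Function.Bundles using (_⇔_; mk⇔)
open import Relation.Unary using (｛_｝; _⊆_; ⋃)
open import Relation.Binary.PropositionalEquality using (refl)

onSingletons : ∀ {ℓ q} {X Y : Set ℓ} → (𝒫 X → 𝒫 Y → Set q) → X → Y → Set q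
onSingletons Q x y = Q ｛ x ｝ ｛ y ｝

singleton-isAtom : ∀ {ℓ} {X : Set ℓ} (x : X) → IsAtom ｛ x ｝
singleton-isAtom x = x , id , id

⊆-⋃-singletons : ∀ {ℓ} {X : Set ℓ} (A : 𝒫 X) → A ⊆ ⋃ (∃ A) (λ i → ｛ proj₁ i ｝)
⊆-⋃-singletons A {x} x∈A = (x , x∈A) , refl

module _ {ℓ q} {X Y : Set ℓ} {Q : 𝒫 X → 𝒫 Y → Set q} (da : DirectionallyAtomic Q) where
  open DirectionallyAtomic da

  antitoneˡ : ∀ {A A′ B} → A′ ⊆ A → Q A B → Q A′ B
  antitoneˡ A′⊆A qAB = bimodule A′⊆A qAB id

  monotoneʳ : ∀ {A B B′} → Q A B → B ⊆ B′ → Q A B′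
  monotoneʳ qAB B⊆B′ = bimodule id qAB B⊆B′

  Q⇒Low : ∀ {A B} → Q A B → Low (onSingletons Q) A B
  Q⇒Low {A} {B} qAB a a∈A
    with atomic-founded ｛ a ｝ B (singleton-isAtom a) (antitoneˡ (λ { refl → a∈A }) qAB)
  ... | b′ , (y , b′⊆｛y｝ , ｛y｝⊆b′) , b′⊆B , qab′ =
    y , b′⊆B (｛y｝⊆b′ refl) , monotoneʳ qab′ b′⊆｛y｝

  Low⇒Q : ∀ {A B} → Low (onSingletons Q) A B → Q A B
  Low⇒Q {A} {B} low =
    antitoneˡ (⊆-⋃-singletons A) (left-disjunctive (∃ A) (λ i → ｛ proj₁ i ｝) B singleton-below)
    where
    singleton-below : ∀ (i : ∃ A) → Q ｛ proj₁ i ｝ B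
    singleton-below (a , a∈A) with low a a∈A
    ... | y , y∈B , qay = monotoneʳ qay (λ { refl → y∈B })

  Q⇔Low : ∀ A B → Q A B ⇔ Low (onSingletons Q) A B
  Q⇔Low A B = mk⇔ Q⇒Low Low⇒Q

onSingletons-isSimulation : ∀ {ℓ q} {X Y : Set ℓ} {R : Frame-Rel X} {S : Frame-Rel Y}
  {Q : 𝒫 X → 𝒫 Y → Set q} → IsSimulatory R S Q → IsSimulation R S (onSingletons Q)
onSingletons-isSimulation {R = R} {S} {Q} sim x y x′ qxy xRx′ =
  Q⇒Low dir-atomic qx′Sy x′ refl
  where
  open IsSimulatory sim
  ｛y｝⊆□Sy : ｛ y ｝ ⊆ □ S (S y)
  ｛y｝⊆□Sy refl v ySv = ySv
  ｛x′｝⊆◇⁻｛x｝ : ｛ x′ ｝ ⊆ ◇⁻ R ｛ x ｝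
  ｛x′｝⊆◇⁻｛x｝ refl = x , refl , xRx′
  qx′Sy : Q ｛ x′ ｝ (S y)
  qx′Sy = antitoneˡ dir-atomic ｛x′｝⊆◇⁻｛x｝
            (box-cond ｛ x ｝ (S y) (monotoneʳ dir-atomic qxy ｛y｝⊆□Sy))

mainTheorem15 : ∀ {ℓ q} {X Y : Set ℓ} (R : Frame-Rel X) (S : Frame-Rel Y)
                  (Q : 𝒫 X → 𝒫 Y → Set q) → IsSimulatory R S Q →
                  Σ (X → Y → Set q) (λ T → IsSimulation R S T ×
                    (∀ (A : 𝒫 X) (B : 𝒫 Y) → Q A B ⇔ Low T A B))
mainTheorem15 R S Q sim =
  onSingletons Q , onSingletons-isSimulation sim , Q⇔Low (IsSimulatory.dir-atomic sim)
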